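{- Let $s$ be a string, let $i$ be a position, and let $s[i\,..\,i+t_1),\dots,s[i\,..\,i+t_k)$ be all right closed repeats starting at position $i$, with respective next occurrences $s[q_1\,..\,q_1+t_1),\dots,s[q_k\,..\,q_k+t_k)$, where $t_1<\cdots<t_k$. Then for every $x\in\{1,\dots,k-2\}$ we have $q_{x+2}>q_x+t_x$.
   Context: For a string $s$ of length $n$, $s[i\,..\,j]$ denotes $s[i]\cdots s[j]$ and $s[i\,..\,j)$ denotes $s[i\,..\,j-1]$. A string $t$ occurs at position $i$ if $s[i\,..\,i+|t|)=t$. A non-empty substring $s[i\,..\,j]$ is a right closed repeat if it has an occurrence $s[i'\,..\,j']=s[i\,..\,j]$ with $i'>i$ such that $s[i\,..\,j]$ does not occur at positions $i+1,\dots,i'-1$, and either $j'=n$ or $s[j+1]\ne s[j'+1]$; $s[i'\,..\,j']$ is called its next occurrence. -}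

module Defs where

open import Data.Nat using (ℕ; zero; suc; _+_; _≤_; _<_)
open import Data.List using (List; []; _∷_; length)
open import Data.Maybe using (Maybe; just; nothing)
open import Data.Product using (_×_; Σ; ∃)
open import Data.Sum using (_⊎_)
open import Relation.Binary.PropositionalEquality using (_≡_; _≢_)
open import Relation.Nullary using (¬_)

-- Positions are 0-indexed: the character at position p of s is  s ‼ p
-- (= just c for p < length s, nothing otherwise).
_‼_ : ∀ {a} {A : Set a} → List A → ℕ → Maybe A
[]       ‼ _       = nothing
(c ∷ s)  ‼ zero    = just c
(c ∷ s)  ‼ (suc p) = s ‼ p

module _ {a} {A : Set a} (s : List A) where

  OccursAt : (i t p : ℕ) → Set a
  OccursAt i t p =
    (i + t ≤ length s) × (p + t ≤ length s) ×
    (∀ m → m < t → s ‼ (p + m) ≡ s ‼ (i + m))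

  NextOcc : (i t q : ℕ) → Set a
  NextOcc i t q =
    (i < q) × OccursAt i t q × (∀ p → i < p → p < q → ¬ OccursAt i t p)

  RightClosedRepeat : (i t q : ℕ) → Set a
  RightClosedRepeat i t q =
    (0 < t) × NextOcc i t q ×
    ((q + t ≡ length s) ⊎ ((q + t < length s) × (s ‼ (i + t) ≢ s ‼ (q + t))))

{-# OPTIONS --safe #-}
module Submission where

open import Defs
open import Data.Nat using (ℕ; suc; _+_; _<_; _≤_; z≤n; z<s; _<?_)
open import Data.Nat.Properties
open import Data.Nat.Tactic.RingSolver using (solve-∀)
open import Data.List using (List)
open import Data.Product using (_×_; ∃; _,_)
open import Data.Sum using (inj₁; inj₂)
open import Relation.Nullary using (¬_; yes; no; contradiction)
open import Relation.Binary.PropositionalEquality using (_≡_; refl; sym; cong; module ≡-Reasoning)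

-- The next occurrence of a longer right closed repeat at i is also an
-- occurrence of every shorter one, and it differs from the shorter one's next
-- occurrence (else that one would extend by a letter); so t₁ < t₂ < t₃ gives
-- q₁ < q₂ < q₃.  If moreover q₃ ≤ q₁ + t₁, the overlapping copies at q₁, q₂, q₃
-- of prefixes of s[i ..] force s[q₁+t₁] = s[i+t₁]: the occurrence at q₁ extends
-- by one letter, contradicting right closedness of s[i .. i+t₁).

module _ {a} {X : Set a} (s : List X) (i : ℕ) where

  Matches : ℕ → ℕ → Set a
  Matches p t = ∀ m → m < t → s ‼ (p + m) ≡ s ‼ (i + m)

  matches-suc : ∀ {p t} → Matches p t → s ‼ (p + t) ≡ s ‼ (i + t) → Matches p (suc t)
  matches-suc match next m m<1+t with m<1+n⇒m<n∨m≡n m<1+t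
  ... | inj₁ m<t  = match m m<t
  ... | inj₂ refl = next

  occursAt-≤ : ∀ {t t′ p} → t′ ≤ t → OccursAt s i t p → OccursAt s i t′ p
  occursAt-≤ {p = p} t′≤t (i+t≤n , p+t≤n , match) =
    ≤-trans (+-monoʳ-≤ i t′≤t) i+t≤n ,
    ≤-trans (+-monoʳ-≤ p t′≤t) p+t≤n ,
    λ m m<t′ → match m (<-≤-trans m<t′ t′≤t)

  nextOcc-minimal : ∀ {t q p} → NextOcc s i t q → i < p → OccursAt s i t p → q ≤ p
  nextOcc-minimal (_ , _ , noneBetween) i<p occ = ≮⇒≥ λ p<q → noneBetween _ i<p p<q occ

  rightClosed-maximal : ∀ {t t′ q} → RightClosedRepeat s i t q → t < t′ → ¬ OccursAt s i t′ q
  rightClosed-maximal {q = q} (_ , _ , inj₁ q+t≡n) t<t′ (_ , q+t′≤n , _) =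
    <-irrefl q+t≡n (<-≤-trans (+-monoʳ-< q t<t′) q+t′≤n)
  rightClosed-maximal (_ , _ , inj₂ (_ , differ)) t<t′ (_ , _ , match) =
    differ (sym (match _ t<t′))

  rightClosed-nextOcc-< : ∀ {t t′ q q′} → RightClosedRepeat s i t q → RightClosedRepeat s i t′ q′ →
                          t < t′ → q < q′
  rightClosed-nextOcc-< rcr@(_ , next , _) (_ , (i<q′ , occ′ , _) , _) t<t′ =
    ≤∧≢⇒< (nextOcc-minimal next i<q′ (occursAt-≤ (<⇒≤ t<t′) occ′))
          λ { refl → rightClosed-maximal rcr t<t′ occ′ }

  overlapping-matches-extend : ∀ {p e c r t₂ t₃} → e < c → c + r < t₂ → c + r ≤ t₃ →
    Matches p (c + r) → Matches (p + e) t₂ → Matches (p + c) t₃ →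
    s ‼ (p + (c + r)) ≡ s ‼ (i + (c + r))
  overlapping-matches-extend {p} {e} {c} {r} e<c t₁<t₂ t₁≤t₃ match₁ match₂ match₃ = begin
    s ‼ (p + (c + r))       ≡⟨ cong (s ‼_) (sym (+-assoc p c r)) ⟩
    s ‼ (p + c + r)         ≡⟨ match₃ r (<-≤-trans r<t₁ t₁≤t₃) ⟩
    s ‼ (i + r)             ≡⟨ sym (match₂ r (<-trans r<t₁ t₁<t₂)) ⟩
    s ‼ (p + e + r)         ≡⟨ cong (s ‼_) (+-assoc p e r) ⟩
    s ‼ (p + (e + r))       ≡⟨ match₁ (e + r) e+r<t₁ ⟩
    s ‼ (i + (e + r))       ≡⟨ sym (match₃ (e + r) (<-≤-trans e+r<t₁ t₁≤t₃)) ⟩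
    s ‼ (p + c + (e + r))   ≡⟨ cong (s ‼_) (shift-swap p c e r) ⟩
    s ‼ (p + e + (c + r))   ≡⟨ match₂ (c + r) t₁<t₂ ⟩
    s ‼ (i + (c + r))       ∎
    where
    open ≡-Reasoning
    shift-swap : ∀ p c e r → p + c + (e + r) ≡ p + e + (c + r)
    shift-swap = solve-∀
    e+r<t₁ : e + r < c + r
    e+r<t₁ = +-monoˡ-< r e<c
    r<t₁ : r < c + r
    r<t₁ = m<n+m r (≤-<-trans z≤n e<c)

  overlapping-occurrences-extend : ∀ {q₁ q₂ q₃ t₁ t₂ t₃} → q₁ ≤ q₂ → q₂ < q₃ → q₃ ≤ q₁ + t₁ →
    t₁ < t₂ → t₁ ≤ t₃ → Matches q₁ t₁ → Matches q₂ t₂ → Matches q₃ t₃ →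
    s ‼ (q₁ + t₁) ≡ s ‼ (i + t₁)
  overlapping-occurrences-extend {q₁} q₁≤q₂ q₂<q₃ q₃≤q₁+t₁
    with e , refl ← m≤n⇒∃[o]m+o≡n q₁≤q₂
    with c , refl ← m≤n⇒∃[o]m+o≡n (≤-trans q₁≤q₂ (<⇒≤ q₂<q₃))
    with r , refl ← m≤n⇒∃[o]m+o≡n (+-cancelˡ-≤ q₁ _ _ q₃≤q₁+t₁) =
    overlapping-matches-extend (+-cancelˡ-< q₁ _ _ q₂<q₃)

  rightClosed-nextOcc-disjoint : ∀ {t₁ t₂ t₃ q₁ q₂ q₃} →
    RightClosedRepeat s i t₁ q₁ → RightClosedRepeat s i t₂ q₂ → RightClosedRepeat s i t₃ q₃ →
    t₁ < t₂ → t₂ < t₃ → q₁ + t₁ < q₃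
  rightClosed-nextOcc-disjoint {t₁} {q₁ = q₁} {q₃ = q₃}
    r₁@(_ , (_ , (_ , _ , match₁) , _) , _) r₂@(_ , (_ , (i+t₂≤n , _ , match₂) , _) , _)
    r₃@(_ , (_ , (_ , q₃+t₃≤n , match₃) , _) , _) t₁<t₂ t₂<t₃ with q₁ + t₁ <? q₃
  ... | yes before = before
  ... | no notBefore = contradiction extended (rightClosed-maximal r₁ (n<1+n t₁))
    where
    q₁<q₂ = rightClosed-nextOcc-< r₁ r₂ t₁<t₂
    q₂<q₃ = rightClosed-nextOcc-< r₂ r₃ t₂<t₃
    t₁<t₃ = <-trans t₁<t₂ t₂<t₃
    extended : OccursAt s i (suc t₁) q₁
    extended =
      ≤-trans (+-monoʳ-≤ i t₁<t₂) i+t₂≤n ,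
      ≤-trans (+-mono-≤ (<⇒≤ (<-trans q₁<q₂ q₂<q₃)) t₁<t₃) q₃+t₃≤n ,
      matches-suc match₁
        (overlapping-occurrences-extend (<⇒≤ q₁<q₂) q₂<q₃ (≮⇒≥ notBefore) t₁<t₂ (<⇒≤ t₁<t₃)
          match₁ match₂ match₃)

lemma2 : ∀ {a} {A : Set a} (s : List A) (i k : ℕ) (t q : ℕ → ℕ) →
           (∀ x y → x < y → y < k → t x < t y) →
           (∀ x → x < k → RightClosedRepeat s i (t x) (q x)) →
           (∀ t′ q′ → RightClosedRepeat s i t′ q′ → ∃ λ x → (x < k) × (t x ≡ t′)) →
           ∀ x → x + 2 < k → q x + t x < q (x + 2)
-- Only three consecutive repeats are used.
lemma2 s i k t q t-increasing repeat _ x x+2<k =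
  rightClosed-nextOcc-disjoint s i (repeat x x<k) (repeat (x + 1) x+1<k) (repeat (x + 2) x+2<k)
    (t-increasing x (x + 1) x<x+1 x+1<k) (t-increasing (x + 1) (x + 2) x+1<x+2 x+2<k)
  where
  x<x+1 : x < x + 1
  x<x+1 = m<m+n x z<s
  x+1<x+2 : x + 1 < x + 2
  x+1<x+2 = +-monoʳ-< x (n<1+n 1)
  x+1<k : x + 1 < k
  x+1<k = <-trans x+1<x+2 x+2<k
  x<k : x < k
  x<k = <-trans x<x+1 x+1<k
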